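{- Let $h\colon A\to B$ be a homomorphism of distributive lattices and let $f=h_*\colon B_*\to A_*$ be its Priestley dual. Then $h$ is Frobenius if, and only if, $f$ is bounded.
   Context: Distributive lattices are bounded; $A_*$ denotes the Priestley dual space (lattice homomorphisms $A\to 2$ with the pointwise order and the subspace topology of $2^A$), and $h_*(x)=x\circ h$. A homomorphism $h\colon A\to B$ is Frobenius if for every $a\in A$, every $c\in A$ with $c\le a$ and every $b\in B$ with $b\wedge h(a)\le h(c)$, there is $a'\in A$ with $b\le h(a')$ and $a\wedge a'\le c$ (equivalently, the square formed by $p_a\colon A\to{\downarrow}a$, $p_a(x)=a\wedge x$, $h$, $p_{h(a)}\colon B\to{\downarrow}h(a)$ and the restriction $h|_{{\downarrow}a}$ has the interpolation property). A map between posets is bounded if the image of every up-set is an up-set. -}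

module Defs where

open import Level using (Level; _⊔_; suc; 0ℓ)
open import Data.Bool using (Bool; true; false)
import Data.Bool as 𝔹
open import Data.Bool.Properties using (∨-∧-distributiveLattice; ∨-identity; ∧-identity)
open import Data.Product using (Σ; ∃; ∃-syntax; _×_; _,_)
open import Relation.Binary.PropositionalEquality using (_≡_)
open import Relation.Unary using (Pred)
import Data.Empty
open import Algebra.Definitions using (Identity)
open import Algebra.Lattice.Bundles using (DistributiveLattice)
open import Algebra.Lattice.Morphism.Structures using (module LatticeMorphisms)

record BoundedDistributiveLattice c ℓ : Set (suc (c ⊔ ℓ)) where
  field
    distributiveLattice : DistributiveLattice c ℓ
  open DistributiveLattice distributiveLattice public
  field
    ⊥ : Carrier
    ⊤ : Carrier
    ∨-identity-⊥ : Identity _≈_ ⊥ _∨_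
    ∧-identity-⊤ : Identity _≈_ ⊤ _∧_

  infix 4 _≤_
  _≤_ : Carrier → Carrier → Set ℓ
  x ≤ y = x ∧ y ≈ x

open BoundedDistributiveLattice using (Carrier)

record IsBDLHomomorphism {a ℓa b ℓb}
    (A : BoundedDistributiveLattice a ℓa) (B : BoundedDistributiveLattice b ℓb)
    (h : Carrier A → Carrier B) : Set (a ⊔ ℓa ⊔ ℓb) where
  private
    module A = BoundedDistributiveLattice A
    module B = BoundedDistributiveLattice B
  open LatticeMorphisms A.rawLattice B.rawLattice using (IsLatticeHomomorphism)
  field
    isLatticeHomomorphism : IsLatticeHomomorphism h
    ⊥-homo : h A.⊥ B.≈ B.⊥
    ⊤-homo : h A.⊤ B.≈ B.⊤

𝟚 : BoundedDistributiveLattice 0ℓ 0ℓ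
𝟚 = record
  { distributiveLattice = ∨-∧-distributiveLattice
  ; ⊥ = false
  ; ⊤ = true
  ; ∨-identity-⊥ = ∨-identity
  ; ∧-identity-⊤ = ∧-identity
  }

-- The Priestley dual poset A_* (order structure only; the topology is
-- not needed for the notions used below)

record Point {a ℓ} (A : BoundedDistributiveLattice a ℓ) : Set (a ⊔ ℓ) where
  constructor point
  field
    fun   : Carrier A → Bool
    isHom : IsBDLHomomorphism A 𝟚 fun
open Point public

module _ {a ℓ} {A : BoundedDistributiveLattice a ℓ} where

  _≤ₚ_ : Point A → Point A → Set a
  x ≤ₚ y = ∀ u → fun x u 𝔹.≤ fun y u

  _≈ₚ_ : Point A → Point A → Set a
  x ≈ₚ y = ∀ u → fun x u ≡ fun y u

dualMap : ∀ {a ℓa b ℓb}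
  {A : BoundedDistributiveLattice a ℓa} {B : BoundedDistributiveLattice b ℓb}
  (h : Carrier A → Carrier B) → IsBDLHomomorphism A B h →
  Point B → Point A
dualMap {A = A} {B} h hh x = point (λ u → fun x (h u)) (compHom (isHom x))
  where
  module A = BoundedDistributiveLattice A
  module B = BoundedDistributiveLattice B
  module H = IsBDLHomomorphism hh
  compHom : IsBDLHomomorphism B 𝟚 (fun x) → IsBDLHomomorphism A 𝟚 (λ u → fun x (h u))
  compHom hx = record
    { isLatticeHomomorphism = record
      { isRelHomomorphism = record { cong = λ e → X.⟦⟧-cong (HL.⟦⟧-cong e) }
      ; ∧-homo = λ u v → Eq.trans (X.⟦⟧-cong (HL.∧-homo u v)) (X.∧-homo (h u) (h v))
      ; ∨-homo = λ u v → Eq.trans (X.⟦⟧-cong (HL.∨-homo u v)) (X.∨-homo (h u) (h v))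
      }
    ; ⊥-homo = Eq.trans (X.⟦⟧-cong H.⊥-homo) (IsBDLHomomorphism.⊥-homo hx)
    ; ⊤-homo = Eq.trans (X.⟦⟧-cong H.⊤-homo) (IsBDLHomomorphism.⊤-homo hx)
    }
    where
    import Relation.Binary.PropositionalEquality as Eq
    module X = LatticeMorphisms.IsLatticeHomomorphism (IsBDLHomomorphism.isLatticeHomomorphism hx)
    module HL = LatticeMorphisms.IsLatticeHomomorphism H.isLatticeHomomorphism

module _ {x y ℓ₁ ℓ₂ ℓ₃ ℓ₄ : Level}
  {X : Set x} (_≈X_ : X → X → Set ℓ₁) (_≤X_ : X → X → Set ℓ₂)
  {Y : Set y} (_≈Y_ : Y → Y → Set ℓ₃) (_≤Y_ : Y → Y → Set ℓ₄) where

  image : ∀ {p} → (X → Y) → Pred X p → Pred Y (x ⊔ p ⊔ ℓ₃)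
  image f U yy = ∃[ xx ] (U xx × f xx ≈Y yy)

  IsBoundedMap : ∀ p → (X → Y) → Set (suc p ⊔ x ⊔ y ⊔ ℓ₂ ⊔ ℓ₃ ⊔ ℓ₄)
  IsBoundedMap p f =
    (U : Pred X p) → (∀ {u v} → u ≤X v → U u → U v) →
    ∀ {u v} → u ≤Y v → image f U u → image f U v

module _ {a ℓa b ℓb}
  (A : BoundedDistributiveLattice a ℓa) (B : BoundedDistributiveLattice b ℓb) where
  private
    module A = BoundedDistributiveLattice A
    module B = BoundedDistributiveLattice B

  IsFrobenius : (Carrier A → Carrier B) → Set (a ⊔ b ⊔ ℓa ⊔ ℓb)
  IsFrobenius h =
    ∀ (u c : Carrier A) → c A.≤ u →
    ∀ (w : Carrier B) → (w B.∧ h u) B.≤ h c →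
    ∃[ u' ] (w B.≤ h u' × (u A.∧ u') A.≤ c)

-- Filters, ideals and the prime filter theorem (a classical principle
-- of the ambient metatheory, supplied as a hypothesis)

module _ {a ℓ} (L : BoundedDistributiveLattice a ℓ) where
  private
    module L = BoundedDistributiveLattice L

  record IsFilter {p} (F : Pred (Carrier L) p) : Set (a ⊔ ℓ ⊔ p) where
    field
      ⊤-mem   : F L.⊤
      up      : ∀ {u v} → u L.≤ v → F u → F v
      ∧-close : ∀ {u v} → F u → F v → F (u L.∧ v)

  record IsIdeal {p} (I : Pred (Carrier L) p) : Set (a ⊔ ℓ ⊔ p) where
    field
      ⊥-mem   : I L.⊥
      down    : ∀ {u v} → u L.≤ v → I v → I u
      ∨-close : ∀ {u v} → I u → I v → I (u L.∨ v)

  PrimeFilterTheorem : ∀ p → Set (a ⊔ ℓ ⊔ suc p)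
  PrimeFilterTheorem p =
    (F I : Pred (Carrier L) p) → IsFilter F → IsIdeal I →
    (∀ u → F u → I u → Data.Empty.⊥) →
    Σ (Point L) λ x → ((∀ u → F u → fun x u ≡ true) × (∀ u → I u → fun x u ≡ false))

-- Read pointwise in the dual, the Frobenius condition is the back condition of
-- a p-morphism: whenever h_* y ≤ v there is y' ≥ y with h_* y' = v. Such a y'
-- is a prime filter containing y and h[v] but missing the ideal generated by
-- h[A ∖ v]; the prime filter theorem provides it exactly when that filter and
-- ideal are disjoint, and the Frobenius condition is what makes them disjoint.
-- Conversely, if the Frobenius witness a' is missing, the prime filter theorem
-- gives a point z ∋ a with c ∉ z and a point y ∋ b with h_* y ≤ z; lifting y
-- along the back condition to y' with h_* y' = z puts b ∧ h(a) in y' but not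
-- h(c), contradicting b ∧ h(a) ≤ h(c).
module Submission where

open import Defs
open import Level using (Level; _⊔_; Lift; lift; lower)
open import Axiom.ExcludedMiddle using (ExcludedMiddle)
open import Axiom.DoubleNegationElimination using (em⇒dne)
open import Function.Base using (_∘_)
open import Function.Bundles using (_⇔_; mk⇔)
open import Data.Bool using (true; false; b≤b)
import Data.Bool as 𝔹
import Data.Bool.Properties as 𝔹
import Data.Empty as Empty
open import Data.Product using (Σ; ∃-syntax; _×_; _,_; proj₁; proj₂)
open import Relation.Binary.Definitions using (Reflexive; Transitive; Trans)
open import Relation.Binary.PropositionalEquality using (_≡_; _≢_; refl; module ≡-Reasoning)
import Relation.Binary.PropositionalEquality as ≡
open import Relation.Nullary using (¬_)
open import Relation.Unary using (Pred)
import Algebra.Lattice.Properties.Lattice as LatticeProperties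
import Relation.Binary.Lattice as OrderTheoretic
open import Algebra.Lattice.Morphism.Structures using (module LatticeMorphisms)

module LatticeOrder {c ℓ} (L : BoundedDistributiveLattice c ℓ) where
  open BoundedDistributiveLattice L public
  private
    module O = OrderTheoretic.Lattice (LatticeProperties.∨-∧-orderTheoreticLattice lattice)

  -- O orders by x ≈ x ∧ y, the symmetric form of _≤_.
  ≤-refl : ∀ {x} → x ≤ x
  ≤-refl = sym O.refl

  ≤-trans : ∀ {x y z} → x ≤ y → y ≤ z → x ≤ z
  ≤-trans p q = sym (O.trans (sym p) (sym q))

  ≤-respʳ-≈ : ∀ {x y z} → x ≤ y → y ≈ z → x ≤ z
  ≤-respʳ-≈ p e = ≤-trans p (sym (O.reflexive e))

  x∧y≤x : ∀ x y → x ∧ y ≤ x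
  x∧y≤x x y = sym (O.x∧y≤x x y)

  x∧y≤y : ∀ x y → x ∧ y ≤ y
  x∧y≤y x y = sym (O.x∧y≤y x y)

  ∧-greatest : ∀ {x y z} → x ≤ y → x ≤ z → x ≤ y ∧ z
  ∧-greatest p q = sym (O.∧-greatest (sym p) (sym q))

  ∨-least : ∀ {x y z} → x ≤ z → y ≤ z → x ∨ y ≤ z
  ∨-least p q = sym (O.∨-least (sym p) (sym q))

  x≤x∨y : ∀ x y → x ≤ x ∨ y
  x≤x∨y x y = sym (O.x≤x∨y x y)

  y≤x∨y : ∀ x y → y ≤ x ∨ y
  y≤x∨y x y = sym (O.y≤x∨y x y)

  ∧-monotonic : ∀ {x x' y y'} → x ≤ x' → y ≤ y' → x ∧ y ≤ x' ∧ y'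
  ∧-monotonic p q = ∧-greatest (≤-trans (x∧y≤x _ _) p) (≤-trans (x∧y≤y _ _) q)

  ≤-⊤ : ∀ x → x ≤ ⊤
  ≤-⊤ = proj₂ ∧-identity-⊤

  ⊥-≤ : ∀ x → ⊥ ≤ x
  ⊥-≤ x = trans (∧-congˡ (sym (proj₁ ∨-identity-⊥ x))) (∧-absorbs-∨ ⊥ x)

module PointProperties {c ℓ} {L : BoundedDistributiveLattice c ℓ} (x : Point L) where
  private
    module L = BoundedDistributiveLattice L
    module X = LatticeMorphisms.IsLatticeHomomorphism
                 (IsBDLHomomorphism.isLatticeHomomorphism (isHom x))

  ⊤-true : fun x L.⊤ ≡ true
  ⊤-true = IsBDLHomomorphism.⊤-homo (isHom x)

  ⊥-false : fun x L.⊥ ≡ false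
  ⊥-false = IsBDLHomomorphism.⊥-homo (isHom x)

  ∧-true : ∀ {u v} → fun x u ≡ true → fun x v ≡ true → fun x (u L.∧ v) ≡ true
  ∧-true {u} {v} p q = ≡.trans (X.∧-homo u v) (≡.cong₂ 𝔹._∧_ p q)

  ∨-false : ∀ {u v} → fun x u ≡ false → fun x v ≡ false → fun x (u L.∨ v) ≡ false
  ∨-false {u} {v} p q = ≡.trans (X.∨-homo u v) (≡.cong₂ 𝔹._∨_ p q)

  monotone : ∀ {u v} → u L.≤ v → fun x u ≡ true → fun x v ≡ true
  monotone {u} {v} u≤v xu = begin
    fun x v                ≡⟨ ≡.cong (𝔹._∧ fun x v) xu ⟨
    fun x u 𝔹.∧ fun x v    ≡⟨ X.∧-homo u v ⟨
    fun x (u L.∧ v)        ≡⟨ X.⟦⟧-cong u≤v ⟩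
    fun x u                ≡⟨ xu ⟩
    true                   ∎
    where open ≡-Reasoning

true≢false : true ≢ false
true≢false ()

≤-fromTrue : ∀ {b b'} → (b ≡ true → b' ≡ true) → b 𝔹.≤ b'
≤-fromTrue {false} _ = 𝔹.≤-minimum _
≤-fromTrue {true}  k = 𝔹.≤-reflexive (≡.sym (k refl))

≤-fromFalse : ∀ {b b'} → (b' ≡ false → b ≡ false) → b 𝔹.≤ b'
≤-fromFalse {b' = true}  _ = 𝔹.≤-maximum _
≤-fromFalse {b' = false} k = 𝔹.≤-reflexive (k refl)

≤-preservesTrue : ∀ {b b'} → b 𝔹.≤ b' → b ≡ true → b' ≡ true
≤-preservesTrue b≤b e = e

module _ {c ℓ} {L : BoundedDistributiveLattice c ℓ} where

  ≤ₚ-refl : Reflexive (_≤ₚ_ {A = L})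
  ≤ₚ-refl u = 𝔹.≤-refl

  ≤ₚ-trans : Transitive (_≤ₚ_ {A = L})
  ≤ₚ-trans p q u = 𝔹.≤-trans (p u) (q u)

  ≈ₚ-≤ₚ-trans : Trans (_≈ₚ_ {A = L}) _≤ₚ_ _≤ₚ_
  ≈ₚ-≤ₚ-trans e p u rewrite e u = p u

module _ {x y ℓ₂ ℓ₃ ℓ₄ : Level}
  {X : Set x} (_≤X_ : X → X → Set ℓ₂)
  {Y : Set y} (_≈Y_ : Y → Y → Set ℓ₃) (_≤Y_ : Y → Y → Set ℓ₄) where

  BackCondition : (X → Y) → Set (x ⊔ y ⊔ ℓ₂ ⊔ ℓ₃ ⊔ ℓ₄)
  BackCondition f = ∀ u v → f u ≤Y v → ∃[ u' ] (u ≤X u' × f u' ≈Y v)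

module _ {x y ℓ₁ ℓ₂ ℓ₃ ℓ₄ : Level}
  {X : Set x} (_≈X_ : X → X → Set ℓ₁) (_≤X_ : X → X → Set ℓ₂)
  {Y : Set y} (_≈Y_ : Y → Y → Set ℓ₃) (_≤Y_ : Y → Y → Set ℓ₄) where

  backCondition⇒bounded : Trans _≈Y_ _≤Y_ _≤Y_ →
    ∀ {p f} → BackCondition _≤X_ _≈Y_ _≤Y_ f → IsBoundedMap _≈X_ _≤X_ _≈Y_ _≤Y_ p f
  backCondition⇒bounded ≈-≤-trans back U U-up u≤v (u' , Uu' , fu'≈u)
    with back u' _ (≈-≤-trans fu'≈u u≤v)
  ... | v' , u'≤v' , fv'≈v = v' , U-up u'≤v' Uu' , fv'≈v

  bounded⇒backCondition : Reflexive _≈Y_ → Reflexive _≤X_ → Transitive _≤X_ →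
    ∀ p {f} → IsBoundedMap _≈X_ _≤X_ _≈Y_ _≤Y_ (ℓ₂ ⊔ p) f → BackCondition _≤X_ _≈Y_ _≤Y_ f
  bounded⇒backCondition ≈-refl ≤-refl ≤-trans p bounded u v fu≤v
    with bounded (λ w → Lift (ℓ₂ ⊔ p) (u ≤X w)) (λ w≤w' (lift u≤w) → lift (≤-trans u≤w w≤w'))
                 fu≤v (u , lift ≤-refl , ≈-refl)
  ... | u' , lift u≤u' , fu'≈v = u' , u≤u' , fu'≈v

module _ {a ℓa b ℓb}
  {A : BoundedDistributiveLattice a ℓa} {B : BoundedDistributiveLattice b ℓb}
  {h : BoundedDistributiveLattice.Carrier A → BoundedDistributiveLattice.Carrier B}
  (hom : IsBDLHomomorphism A B h) where

  private
    ℓ = a ⊔ b ⊔ ℓa ⊔ ℓb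
    module A = LatticeOrder A
    module B = LatticeOrder B
    module H = LatticeMorphisms.IsLatticeHomomorphism
                 (IsBDLHomomorphism.isLatticeHomomorphism hom)
    open PointProperties
    f = dualMap h hom

    ≤-h⊤ : ∀ w → w B.≤ h A.⊤
    ≤-h⊤ w = B.≤-respʳ-≈ (B.≤-⊤ w) (B.sym (IsBDLHomomorphism.⊤-homo hom))

    h-monotone : ∀ {x y} → x A.≤ y → h x B.≤ h y
    h-monotone {x} {y} x≤y = B.trans (B.sym (H.∧-homo x y)) (H.⟦⟧-cong x≤y)

  -- F misses the ideal generated by h[v⁻¹(false)] because h⁻¹F ⊆ v.
  filter⇒pointBelowDual : PrimeFilterTheorem B ℓ →
    ∀ (v : Point A) (F : Pred B.Carrier ℓ) → IsFilter B F →
    (∀ x → F (h x) → fun v x ≡ true) →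
    Σ (Point B) λ y → (∀ w → F w → fun y w ≡ true) × f y ≤ₚ v
  filter⇒pointBelowDual pft v F F-filter h⁻¹F⊆v with pft F I F-filter I-ideal disjoint
    where
    I : Pred B.Carrier ℓ
    I w = Lift ℓ (∃[ x ] (fun v x ≡ false × w B.≤ h x))

    I-ideal : IsIdeal B I
    I-ideal = record
      { ⊥-mem   = lift (A.⊥ , ⊥-false v , B.⊥-≤ _)
      ; down    = λ w≤w' (lift (x , vx , w'≤hx)) → lift (x , vx , B.≤-trans w≤w' w'≤hx)
      ; ∨-close = λ (lift (x , vx , w≤hx)) (lift (x' , vx' , w'≤hx')) →
          lift (x A.∨ x' , ∨-false v vx vx' ,
                B.≤-respʳ-≈ (B.∨-least (B.≤-trans w≤hx (B.x≤x∨y _ _))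
                                       (B.≤-trans w'≤hx' (B.y≤x∨y _ _)))
                            (B.sym (H.∨-homo x x')))
      }

    disjoint : ∀ w → F w → I w → Empty.⊥
    disjoint w Fw (lift (x , vx , w≤hx)) =
      true≢false (≡.trans (≡.sym (h⁻¹F⊆v x (IsFilter.up F-filter w≤hx Fw))) vx)
  ... | y , F⊆y , I∩y=∅ =
    y , F⊆y , λ x → ≤-fromFalse λ vx → I∩y=∅ (h x) (lift (x , vx , B.≤-refl))

  joinFilter : Point B → Point A → Pred B.Carrier ℓ
  joinFilter y v w = Lift ℓ (∃[ w₀ ] ∃[ x ] (fun y w₀ ≡ true × fun v x ≡ true × w₀ B.∧ h x B.≤ w))

  joinFilter-isFilter : ∀ y v → IsFilter B (joinFilter y v)
  joinFilter-isFilter y v = record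
    { ⊤-mem   = lift (B.⊤ , A.⊤ , ⊤-true y , ⊤-true v , B.≤-⊤ _)
    ; up      = λ w≤w' (lift (w₀ , x , yw₀ , vx , ≤w)) → lift (w₀ , x , yw₀ , vx , B.≤-trans ≤w w≤w')
    ; ∧-close = λ (lift (w₀ , x , yw₀ , vx , ≤w)) (lift (w₀' , x' , yw₀' , vx' , ≤w')) →
        lift (w₀ B.∧ w₀' , x A.∧ x' , ∧-true y yw₀ yw₀' , ∧-true v vx vx' ,
              B.∧-greatest
                (B.≤-trans (B.∧-monotonic (B.x∧y≤x _ _) (h-monotone (A.x∧y≤x _ _))) ≤w)
                (B.≤-trans (B.∧-monotonic (B.x∧y≤y _ _) (h-monotone (A.x∧y≤y _ _))) ≤w'))
    }

  -- Frobenius for a = x and c = x ∧ x' turns w₀ ∧ h x ≤ h x' into some x'' ∈ v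
  -- with x ∧ x'' ≤ x'.
  frobenius⇒joinFilter-h⁻¹⊆ : IsFrobenius A B h → ∀ {y v} → f y ≤ₚ v →
    ∀ x' → joinFilter y v (h x') → fun v x' ≡ true
  frobenius⇒joinFilter-h⁻¹⊆ frob {y} {v} fy≤v x' (lift (w₀ , x , yw₀ , vx , w₀∧hx≤hx'))
    with frob x (x A.∧ x') (A.x∧y≤x _ _) w₀
              (B.≤-respʳ-≈ (B.∧-greatest (B.x∧y≤y _ _) w₀∧hx≤hx') (B.sym (H.∧-homo x x')))
  ... | x'' , w₀≤hx'' , x∧x''≤x∧x' =
    monotone v (A.≤-trans x∧x''≤x∧x' (A.x∧y≤y _ _)) (∧-true v vx vx'')
    where
    vx'' : fun v x'' ≡ true
    vx'' = ≤-preservesTrue (fy≤v x'') (monotone y w₀≤hx'' yw₀)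

  frobenius⇒backCondition : PrimeFilterTheorem B ℓ → IsFrobenius A B h →
    BackCondition (_≤ₚ_ {A = B}) (_≈ₚ_ {A = A}) _≤ₚ_ f
  frobenius⇒backCondition pft frob y v fy≤v
    with filter⇒pointBelowDual pft v (joinFilter y v) (joinFilter-isFilter y v)
           (frobenius⇒joinFilter-h⁻¹⊆ frob {y} {v} fy≤v)
  ... | y' , join⊆y' , fy'≤v = y' , y≤y' , λ x → 𝔹.≤-antisym (fy'≤v x) (v≤fy' x)
    where
    y≤y' : y ≤ₚ y'
    y≤y' w = ≤-fromTrue λ yw → join⊆y' w (lift (w , A.⊤ , yw , ⊤-true v , B.x∧y≤x _ _))
    v≤fy' : v ≤ₚ f y'
    v≤fy' x = ≤-fromTrue λ vx → join⊆y' (h x) (lift (B.⊤ , x , ⊤-true y , vx , B.x∧y≤y _ _))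

  -- The filter ↑u ∧ h⁻¹(↑w) of A avoids c.
  noFrobeniusWitness⇒point : PrimeFilterTheorem A ℓ → ∀ u c w →
    ¬ (∃[ u' ] (w B.≤ h u' × u A.∧ u' A.≤ c)) →
    Σ (Point A) λ z → fun z u ≡ true × fun z c ≡ false × (∀ x → w B.≤ h x → fun z x ≡ true)
  noFrobeniusWitness⇒point pft u c w noWitness
    with pft G ↓c G-filter ↓c-ideal disjoint
    where
    G : Pred A.Carrier ℓ
    G x = Lift ℓ (∃[ g ] (w B.≤ h g × u A.∧ g A.≤ x))

    G-filter : IsFilter A G
    G-filter = record
      { ⊤-mem   = lift (A.⊤ , ≤-h⊤ w , A.≤-⊤ _)
      ; up      = λ x≤x' (lift (g , w≤hg , ≤x)) → lift (g , w≤hg , A.≤-trans ≤x x≤x')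
      ; ∧-close = λ (lift (g , w≤hg , ≤x)) (lift (g' , w≤hg' , ≤x')) →
          lift (g A.∧ g' , B.≤-respʳ-≈ (B.∧-greatest w≤hg w≤hg') (B.sym (H.∧-homo g g')) ,
                A.∧-greatest (A.≤-trans (A.∧-monotonic A.≤-refl (A.x∧y≤x _ _)) ≤x)
                             (A.≤-trans (A.∧-monotonic A.≤-refl (A.x∧y≤y _ _)) ≤x'))
      }

    ↓c : Pred A.Carrier ℓ
    ↓c x = Lift ℓ (x A.≤ c)

    ↓c-ideal : IsIdeal A ↓c
    ↓c-ideal = record
      { ⊥-mem   = lift (A.⊥-≤ c)
      ; down    = λ x≤x' (lift x'≤c) → lift (A.≤-trans x≤x' x'≤c)
      ; ∨-close = λ (lift x≤c) (lift x'≤c) → lift (A.∨-least x≤c x'≤c)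
      }

    disjoint : ∀ x → G x → ↓c x → Empty.⊥
    disjoint x (lift (g , w≤hg , ≤x)) (lift x≤c) = noWitness (g , w≤hg , A.≤-trans ≤x x≤c)
  ... | z , G⊆z , ↓c∩z=∅ =
    z , G⊆z u (lift (A.⊤ , ≤-h⊤ w , A.x∧y≤x _ _)) , ↓c∩z=∅ c (lift A.≤-refl) ,
    λ x w≤hx → G⊆z x (lift (x , w≤hx , A.x∧y≤y _ _))

  backCondition⇒frobenius : ExcludedMiddle ℓ →
    PrimeFilterTheorem A ℓ → PrimeFilterTheorem B ℓ →
    BackCondition (_≤ₚ_ {A = B}) (_≈ₚ_ {A = A}) _≤ₚ_ f → IsFrobenius A B h
  backCondition⇒frobenius em pftA pftB back u c _ w w∧hu≤hc =
    lower (em⇒dne em {Lift ℓ Witness} λ ¬witness → ¬¬witness (¬witness ∘ lift))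
    where
    Witness : Set (a ⊔ ℓa ⊔ ℓb)
    Witness = ∃[ u' ] (w B.≤ h u' × u A.∧ u' A.≤ c)

    ↑w : Pred B.Carrier ℓ
    ↑w w' = Lift ℓ (w B.≤ w')

    ↑w-filter : IsFilter B ↑w
    ↑w-filter = record
      { ⊤-mem   = lift (B.≤-⊤ w)
      ; up      = λ w'≤w'' (lift w≤w') → lift (B.≤-trans w≤w' w'≤w'')
      ; ∧-close = λ (lift w≤w') (lift w≤w'') → lift (B.∧-greatest w≤w' w≤w'')
      }

    ¬¬witness : ¬ ¬ Witness
    ¬¬witness ¬witness
      with noFrobeniusWitness⇒point pftA u c w ¬witness
    ... | z , zu , zc , h⁻¹↑w⊆z
      with filter⇒pointBelowDual pftB z ↑w ↑w-filter (λ x (lift w≤hx) → h⁻¹↑w⊆z x w≤hx)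
    ... | y , ↑w⊆y , fy≤z
      with back y z fy≤z
    ... | y' , y≤y' , fy'≈z = true≢false (≡.trans (≡.sym y'hc) (≡.trans (fy'≈z c) zc))
      where
      y'hc : fun y' (h c) ≡ true
      y'hc = monotone y' w∧hu≤hc
               (∧-true y' (≤-preservesTrue (y≤y' w) (↑w⊆y w (lift B.≤-refl)))
                          (≡.trans (fy'≈z u) zu))

  -- Points are passed explicitly throughout: _≤ₚ_ and _≈ₚ_ only constrain fun,
  -- so the isHom component of an implicit point could never be inferred.
  frobenius⇒bounded : PrimeFilterTheorem B ℓ → IsFrobenius A B h →
    IsBoundedMap (_≈ₚ_ {A = B}) _≤ₚ_ (_≈ₚ_ {A = A}) _≤ₚ_ ℓ f
  frobenius⇒bounded pft frob =
    backCondition⇒bounded (_≈ₚ_ {A = B}) _≤ₚ_ (_≈ₚ_ {A = A}) _≤ₚ_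
      (λ {i j k} → ≈ₚ-≤ₚ-trans {i = i} {j} {k}) {ℓ} {f}
      (frobenius⇒backCondition pft frob)

  bounded⇒frobenius : ExcludedMiddle ℓ → PrimeFilterTheorem A ℓ → PrimeFilterTheorem B ℓ →
    IsBoundedMap (_≈ₚ_ {A = B}) _≤ₚ_ (_≈ₚ_ {A = A}) _≤ₚ_ ℓ f → IsFrobenius A B h
  bounded⇒frobenius em pftA pftB bounded =
    backCondition⇒frobenius em pftA pftB
      (bounded⇒backCondition (_≈ₚ_ {A = B}) _≤ₚ_ (_≈ₚ_ {A = A}) _≤ₚ_
         (λ _ → refl) (λ {x} → ≤ₚ-refl {x = x}) (λ {i j k} → ≤ₚ-trans {i = i} {j} {k})
         ℓ {f} bounded)

proposition4p5 : ∀ {a ℓa b ℓb}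
    (A : BoundedDistributiveLattice a ℓa) (B : BoundedDistributiveLattice b ℓb)
    (h : BoundedDistributiveLattice.Carrier A → BoundedDistributiveLattice.Carrier B)
    (hom : IsBDLHomomorphism A B h) →
    ExcludedMiddle (a ⊔ b ⊔ ℓa ⊔ ℓb) →
    PrimeFilterTheorem A (a ⊔ b ⊔ ℓa ⊔ ℓb) →
    PrimeFilterTheorem B (a ⊔ b ⊔ ℓa ⊔ ℓb) →
    IsFrobenius A B h ⇔
      IsBoundedMap (_≈ₚ_ {A = B}) (_≤ₚ_ {A = B}) (_≈ₚ_ {A = A}) (_≤ₚ_ {A = A})
        (a ⊔ b ⊔ ℓa ⊔ ℓb) (dualMap h hom)
proposition4p5 A B h hom em pftA pftB =
  mk⇔ (frobenius⇒bounded hom pftB) (bounded⇒frobenius hom em pftA pftB)
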